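{- Let $D$ be a loose multipartite tournament, let $X$ be a partite set of $D$ that is not $\{1,2\}$-competing, and let $S\subseteq X$ be an anti-$\{1,2\}$-competing set with $|S|\ge 2$. Then: (1) unless $S$ consists of exactly one non-sink vertex together with sink vertices, the set $\bigcup_{u\in S}N^+(u)$ is contained in a single partite set of $D$; (2) if $|S|\ge 3$, then any two vertices of $V(D)\setminus X$ have a common out-neighbor in $S$.
   Context: All graphs and digraphs are finite and simple. For a digraph $D$ and a vertex $v$, $N^+(v)=\{u:(v,u)\in A(D)\}$ is the out-neighborhood of $v$; a sink is a vertex of outdegree $0$. For vertices $x,y$, $d_D(x,y)$ is the length of a shortest directed path from $x$ to $y$ in $D$ (if it exists). The $(1,2)$-step competition graph $C_{1,2}(D)$ is the graph on $V(D)$ in which distinct $u,v$ are adjacent if and only if there is a vertex $w\notin\{u,v\}$ such that either $d_{D-v}(u,w)\le 1$ and $d_{D-u}(v,w)\le 2$, or $d_{D-u}(v,w)\le 1$ and $d_{D-v}(u,w)\le 2$. A multipartite tournament is an orientation of a complete $k$-partite graph for some $k\ge 3$ (with $k$ nonempty parts, called partite sets). A set of vertices is $\{1,2\}$-competing if it is a clique in $C_{1,2}(D)$ and anti-$\{1,2\}$-competing if it is a stable set in $C_{1,2}(D)$. A multipartite tournament is loose if at least one of its partite sets is not $\{1,2\}$-competing. -}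

module Defs where

open import Data.Nat using (ℕ; _≤_)
open import Data.Fin using (Fin)
open import Data.Fin.Subset using (Subset; _∈_; ∣_∣)
open import Data.Product using (Σ; _×_; ∃)
open import Data.Sum using (_⊎_)
open import Data.Empty using (⊥)
open import Relation.Nullary using (¬_)
open import Relation.Binary.PropositionalEquality using (_≡_; _≢_)

Digraph : ℕ → Set₁
Digraph n = Fin n → Fin n → Set

-- Out-neighbourhood membership: y ∈ N⁺(v) iff (v , y) is an arc.
-- A sink is a vertex of outdegree 0.
Sink : ∀ {n} → Digraph n → Fin n → Set
Sink D v = ∀ y → ¬ D v y

-- d_{D-z}(u,w) ≤ 1   (u, w vertices of D - z)
Dist≤1-avoid : ∀ {n} → Digraph n → Fin n → Fin n → Fin n → Set
Dist≤1-avoid D z u w = u ≢ z × w ≢ z × (u ≡ w ⊎ D u w)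

-- d_{D-z}(u,w) ≤ 2   (u, w vertices of D - z)
Dist≤2-avoid : ∀ {n} → Digraph n → Fin n → Fin n → Fin n → Set
Dist≤2-avoid D z u w =
  u ≢ z × w ≢ z × (u ≡ w ⊎ D u w ⊎ Σ (Fin _) (λ x → x ≢ z × D u x × D x w))

Adj12 : ∀ {n} → Digraph n → Fin n → Fin n → Set
Adj12 D u v = u ≢ v × Σ (Fin _) (λ w → w ≢ u × w ≢ v ×
  ((Dist≤1-avoid D v u w × Dist≤2-avoid D u v w)
   ⊎ (Dist≤1-avoid D u v w × Dist≤2-avoid D v u w)))

Competing12 : ∀ {n} → Digraph n → (Fin n → Set) → Set
Competing12 D X = ∀ u v → X u → X v → u ≢ v → Adj12 D u v

AntiCompeting12 : ∀ {n} → Digraph n → (Fin n → Set) → Set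
AntiCompeting12 D X = ∀ u v → X u → X v → u ≢ v → ¬ Adj12 D u v

mem : ∀ {n} → Subset n → Fin n → Set
mem S x = x ∈ S

record MultipartiteTournament {n : ℕ} (D : Digraph n) : Set where
  field
    k        : ℕ
    3≤k      : 3 ≤ k
    part     : Fin n → Fin k
    nonempty : ∀ i → ∃ λ v → part v ≡ i
    arc-diff : ∀ u v → D u v → part u ≢ part v
    complete : ∀ u v → part u ≢ part v → D u v ⊎ D v u
    oriented : ∀ u v → D u v → ¬ D v u

  PartiteSet : Fin k → Fin n → Set
  PartiteSet i v = part v ≡ i

  Loose : Set
  Loose = Σ (Fin k) (λ i → ¬ Competing12 D (PartiteSet i))

{-# OPTIONS --safe #-}
-- Two distinct vertices u, v of S lie in one partite set, so no arc joins them and all their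
-- out-neighbours lie outside that set.  They cannot have a common out-neighbour,
-- and no out-neighbour of one can dominate an out-neighbour of the other, since either would
-- make u, v adjacent in C_{1,2}(D).  As vertices of different partite sets are joined by an
-- arc, out-neighbours of distinct vertices of S lie in one partite set; a single vertex of S
-- with all others sinks is the only way around this.  For (2), a vertex y outside X is
-- dominated by at most one vertex of S and hence dominates all the others; when |S| ≥ 3 this
-- leaves a vertex of S dominated by both y and z.
module Submission where

open import Defs
open import Data.Nat using (ℕ; _≤_; _<_; suc; s≤s)
open import Data.Nat.Properties using (≤-reflexive; ≤-trans; m≤n⇒m≤1+n; ≤-pred)
open import Data.Fin using (Fin; zero; suc)
open import Data.Fin.Properties using (any?; _≟_)
open import Data.Fin.Subset using (Subset; _∈_; _∉_; ∣_∣; _─_; _-_; ⁅_⁆; Nonempty; inside; outside)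
open import Data.Fin.Subset.Properties using (_∈?_; drop-there; p─⊥≡p; p─q⊆p; x∉⁅y⁆⇒x≢y)
open import Data.Vec using (_∷_; here; there)
open import Data.Product as Product using (Σ; _×_; _,_; ∃)
open import Data.Sum using ([_,_]′; inj₁; inj₂)
open import Data.Empty using (⊥-elim)
open import Function using (_∘_)
open import Relation.Nullary using (¬_; Dec; yes; no)
open import Relation.Nullary.Decidable using (_×-dec_)
open import Relation.Binary.PropositionalEquality using (_≡_; _≢_; refl; sym; trans; cong)

private
  variable
    n : ℕ

x∈p─q⇒x∉q : ∀ {x : Fin n} (p q : Subset n) → x ∈ p ─ q → x ∉ q
x∈p─q⇒x∉q (_ ∷ p) (outside ∷ q) here          = λ ()
x∈p─q⇒x∉q (_ ∷ p) (_       ∷ q) (there x∈p─q) = x∈p─q⇒x∉q p q x∈p─q ∘ drop-there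

∣p∣≤1+∣p-x∣ : ∀ (p : Subset n) x → ∣ p ∣ ≤ suc ∣ p - x ∣
∣p∣≤1+∣p-x∣ (inside  ∷ p) zero    = s≤s (≤-reflexive (cong ∣_∣ (sym (p─⊥≡p p))))
∣p∣≤1+∣p-x∣ (outside ∷ p) zero    = m≤n⇒m≤1+n (≤-reflexive (cong ∣_∣ (sym (p─⊥≡p p))))
∣p∣≤1+∣p-x∣ (inside  ∷ p) (suc x) = s≤s (∣p∣≤1+∣p-x∣ p x)
∣p∣≤1+∣p-x∣ (outside ∷ p) (suc x) = ∣p∣≤1+∣p-x∣ p x

0<∣p∣⇒Nonempty : ∀ (p : Subset n) → 0 < ∣ p ∣ → Nonempty p
0<∣p∣⇒Nonempty (inside  ∷ p) _ = zero , here
0<∣p∣⇒Nonempty (outside ∷ p) 0<∣p∣ = Product.map suc there (0<∣p∣⇒Nonempty p 0<∣p∣)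

∃∈-avoiding₂ : ∀ (p : Subset n) a b → 3 ≤ ∣ p ∣ → ∃ λ x → x ∈ p × x ≢ a × x ≢ b
∃∈-avoiding₂ p a b 3≤∣p∣ with 0<∣p∣⇒Nonempty (p - a - b) 0<∣p-a-b∣
  where
  0<∣p-a-b∣ : 0 < ∣ p - a - b ∣
  0<∣p-a-b∣ = ≤-pred (≤-pred
    (≤-trans 3≤∣p∣ (≤-trans (∣p∣≤1+∣p-x∣ p a) (s≤s (∣p∣≤1+∣p-x∣ (p - a) b)))))
... | x , x∈p-a-b =
  x , p─q⊆p p ⁅ a ⁆ x∈p-a ,
  x∉⁅y⁆⇒x≢y (x∈p─q⇒x∉q p ⁅ a ⁆ x∈p-a) , x∉⁅y⁆⇒x≢y (x∈p─q⇒x∉q (p - a) ⁅ b ⁆ x∈p-a-b)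
  where
  x∈p-a : x ∈ p - a
  x∈p-a = p─q⊆p (p - a) ⁅ b ⁆ x∈p-a-b

module _ (D : Digraph n) {u v w : Fin n}
         (u≢v : u ≢ v) (w≢u : w ≢ u) (w≢v : w ≢ v) (uw : D u w) where

  common-out-neighbour⇒Adj12 : D v w → Adj12 D u v
  common-out-neighbour⇒Adj12 vw =
    u≢v , w , w≢u , w≢v , inj₁ ((u≢v , w≢v , inj₂ uw) , (u≢v ∘ sym , w≢u , inj₂ (inj₁ vw)))

  arc-and-2-path⇒Adj12 : ∀ {x} → x ≢ u → D v x → D x w → Adj12 D u v
  arc-and-2-path⇒Adj12 {x} x≢u vx xw =
    u≢v , w , w≢u , w≢v ,
    inj₁ ((u≢v , w≢v , inj₂ uw) , (u≢v ∘ sym , w≢u , inj₂ (inj₂ (x , x≢u , vx , xw))))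

module MultipartiteTournamentProperties {D : Digraph n} (T : MultipartiteTournament D) where
  open MultipartiteTournament T

  arc? : ∀ u v → Dec (D u v)
  arc? u v with part u ≟ part v
  ... | yes same  = no (λ uv → arc-diff u v uv same)
  ... | no differ = [ yes , no ∘ oriented v u ]′ (complete u v differ)

  arc⇒≢-same-part : ∀ {u a v} → D u a → part u ≡ part v → a ≢ v
  arc⇒≢-same-part {u} {a} ua same refl = arc-diff u a ua same

  ¬arc⇒reverse-arc : ∀ {u v} → part u ≢ part v → ¬ D v u → D u v
  ¬arc⇒reverse-arc {u} {v} differ ¬vu = [ (λ uv → uv) , ⊥-elim ∘ ¬vu ]′ (complete u v differ)

module AntiCompetingInPart {D : Digraph n} (T : MultipartiteTournament D)
  (S : Subset n) (i : Fin (MultipartiteTournament.k T))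
  (S⊆i : ∀ u → u ∈ S → MultipartiteTournament.part T u ≡ i)
  (anti : AntiCompeting12 D (mem S)) where
  open MultipartiteTournament T
  open MultipartiteTournamentProperties T

  private
    same-part : ∀ {u v} → u ∈ S → v ∈ S → part u ≡ part v
    same-part {u} {v} u∈S v∈S = trans (S⊆i u u∈S) (sym (S⊆i v v∈S))

  out-neighbourhoods-disjoint : ∀ {u v y} → u ∈ S → v ∈ S → u ≢ v → D u y → ¬ D v y
  out-neighbourhoods-disjoint {u} {v} u∈S v∈S u≢v uy vy =
    anti u v u∈S v∈S u≢v
      (common-out-neighbour⇒Adj12 D u≢v (arc⇒≢-same-part uy refl)
        (arc⇒≢-same-part uy (same-part u∈S v∈S)) uy vy)

  ¬arc-between-out-neighbours : ∀ {u v a b} → u ∈ S → v ∈ S → u ≢ v → D u a → D v b → ¬ D a b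
  ¬arc-between-out-neighbours {u} {v} u∈S v∈S u≢v ua vb ab =
    anti v u v∈S u∈S (u≢v ∘ sym)
      (arc-and-2-path⇒Adj12 D (u≢v ∘ sym) (arc⇒≢-same-part vb refl)
        (arc⇒≢-same-part vb (same-part v∈S u∈S)) vb
        (arc⇒≢-same-part ua (same-part u∈S v∈S)) ua ab)

  out-neighbours-same-part : ∀ {u v a b} → u ∈ S → v ∈ S → u ≢ v → D u a → D v b →
                             part a ≡ part b
  out-neighbours-same-part {u} {v} {a} {b} u∈S v∈S u≢v ua vb with part a ≟ part b
  ... | yes same  = same
  ... | no differ = ⊥-elim ([ ¬arc-between-out-neighbours u∈S v∈S u≢v ua vb
                            , ¬arc-between-out-neighbours v∈S u∈S (u≢v ∘ sym) vb ua
                            ]′ (complete a b differ))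

  out-neighbourhood-in-one-part :
    ¬ (∃ λ v → v ∈ S × ¬ Sink D v × (∀ u → u ∈ S → u ≢ v → Sink D u)) →
    ∃ λ j → ∀ u y → u ∈ S → D u y → part y ≡ j
  out-neighbourhood-in-one-part ¬sole-non-sink
    with any? (λ u → u ∈? S ×-dec any? (arc? u))
  ... | no all-sinks = i , λ u y u∈S uy → ⊥-elim (all-sinks (u , u∈S , y , uy))
  ... | yes (v , v∈S , a , va) = part a , out-part
    where
    out-part : ∀ u y → u ∈ S → D u y → part y ≡ part a
    out-part u y u∈S uy with u ≟ v
    ... | no u≢v = out-neighbours-same-part u∈S v∈S u≢v uy va
    ... | yes refl with part y ≟ part a
    ... | yes same  = same
    ... | no differ = ⊥-elim (¬sole-non-sink (v , v∈S , (λ sink → sink a va) , others-sinks))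
      where
      others-sinks : ∀ w → w ∈ S → w ≢ v → Sink D w
      others-sinks w w∈S w≢v b wb =
        differ (trans (sym (out-neighbours-same-part w∈S v∈S w≢v wb uy))
                      (out-neighbours-same-part w∈S v∈S w≢v wb va))

  sole-in-neighbour : ∀ y → ∃ λ c → ∀ x → x ∈ S → x ≢ c → ¬ D x y
  sole-in-neighbour y with any? (λ x → x ∈? S ×-dec arc? x y)
  ... | yes (c , c∈S , cy) =
    c , λ x x∈S x≢c → out-neighbourhoods-disjoint c∈S x∈S (x≢c ∘ sym) cy
  ... | no none = y , λ x x∈S _ xy → none (x , x∈S , xy)

  dominates-all-but-one : ∀ {y} → part y ≢ i → ∃ λ c → ∀ x → x ∈ S → x ≢ c → D y x
  dominates-all-but-one {y} y∉i with sole-in-neighbour y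
  ... | c , only-c = c , λ x x∈S x≢c →
    ¬arc⇒reverse-arc (λ py≡px → y∉i (trans py≡px (S⊆i x x∈S))) (only-c x x∈S x≢c)

  common-out-neighbour-in-S : 3 ≤ ∣ S ∣ → ∀ y z → part y ≢ i → part z ≢ i →
                              ∃ λ s → s ∈ S × D y s × D z s
  common-out-neighbour-in-S 3≤∣S∣ y z y∉i z∉i
    with dominates-all-but-one y∉i | dominates-all-but-one z∉i
  ... | c , y⇒S-c | d , z⇒S-d with ∃∈-avoiding₂ S c d 3≤∣S∣
  ... | s , s∈S , s≢c , s≢d = s , s∈S , y⇒S-c s s∈S s≢c , z⇒S-d s s∈S s≢d

proposition3p1 : ∀ {n} (D : Digraph n) (T : MultipartiteTournament D) →
    MultipartiteTournament.Loose T →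
    (X : Fin (MultipartiteTournament.k T)) →
    ¬ Competing12 D (MultipartiteTournament.PartiteSet T X) →
    (S : Subset n) →
    (∀ u → u ∈ S → MultipartiteTournament.PartiteSet T X u) →
    AntiCompeting12 D (mem S) →
    2 ≤ ∣ S ∣ →
    ((¬ Σ (Fin n) (λ v → v ∈ S × ¬ Sink D v × (∀ u → u ∈ S → u ≢ v → Sink D u))) →
      Σ (Fin (MultipartiteTournament.k T)) (λ j →
        ∀ u y → u ∈ S → D u y → MultipartiteTournament.part T y ≡ j))
    × (3 ≤ ∣ S ∣ →
      ∀ y z → MultipartiteTournament.part T y ≢ X → MultipartiteTournament.part T z ≢ X →
        y ≢ z → Σ (Fin n) (λ s → s ∈ S × D y s × D z s))
proposition3p1 D T _ X _ S S⊆X anti _ =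
  out-neighbourhood-in-one-part ,
  λ 3≤∣S∣ y z y∉X z∉X _ → common-out-neighbour-in-S 3≤∣S∣ y z y∉X z∉X
  where open AntiCompetingInPart T S X S⊆X anti
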